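{- Let $D=(\mathcal V,\mathcal A)$ be a $P_{2,2}$-free digraph and $v\in\mathcal V$. Then every vertex $u\in\mathcal V_2(v)\setminus\{v\}$ has at most $d^+(v)-\tau(v)+1$ out-neighbours in common with $v$.
   Context: Digraphs are strict (no loops, no parallel arcs; opposite arcs allowed). $P_{2,2}$ is the digraph on four distinct vertices $a,b,c,d$ with arcs $a\to b$, $b\to d$, $a\to c$, $c\to d$; $D$ is $P_{2,2}$-free if it has no subdigraph isomorphic to $P_{2,2}$. $N^+(v)$, $N^-(v)$ are the out- and in-neighbourhoods of $v$, $d^+(v)=|N^+(v)|$, $\mathcal V_1(v)=N^+(v)$, $\mathcal V_2(v)=\mathcal V\setminus\mathcal V_1(v)$, and $\tau(v)=|N^+(v)\cap N^-(v)|$. -}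

module Defs where

open import Data.Nat using (ℕ)
open import Data.Bool using (Bool; true; false)
open import Data.Fin using (Fin)
open import Data.Fin.Subset using (Subset; _∩_; ∣_∣)
open import Data.Vec using (tabulate)
open import Relation.Binary.PropositionalEquality using (_≡_; _≢_)
open import Relation.Nullary using (¬_)

-- Parallel arcs are impossible
-- by construction; opposite arcs (u→v and v→u) are allowed.
record Digraph (n : ℕ) : Set where
  field
    arc     : Fin n → Fin n → Bool
    loopless : ∀ v → arc v v ≡ false
open Digraph public

Arc : ∀ {n} → Digraph n → Fin n → Fin n → Set
Arc D a b = arc D a b ≡ true

N⁺ : ∀ {n} → Digraph n → Fin n → Subset n
N⁺ D v = tabulate (λ w → arc D v w)

N⁻ : ∀ {n} → Digraph n → Fin n → Subset n
N⁻ D v = tabulate (λ w → arc D w v)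

d⁺ : ∀ {n} → Digraph n → Fin n → ℕ
d⁺ D v = ∣ N⁺ D v ∣

τ : ∀ {n} → Digraph n → Fin n → ℕ
τ D v = ∣ N⁺ D v ∩ N⁻ D v ∣

HasP22 : ∀ {n} → Digraph n → Set
HasP22 {n} D =
  Σ4 λ a b c d →
    (a ≢ b) × (a ≢ c) × (a ≢ d) × (b ≢ c) × (b ≢ d) × (c ≢ d) ×
    Arc D a b × Arc D b d × Arc D a c × Arc D c d
  where
  open import Data.Product using (Σ; _×_)
  Σ4 : (Fin n → Fin n → Fin n → Fin n → Set) → Set
  Σ4 P = Σ (Fin n) λ a → Σ (Fin n) λ b → Σ (Fin n) λ c → Σ (Fin n) λ d → P a b c d

P22-free : ∀ {n} → Digraph n → Set
P22-free D = ¬ HasP22 D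

module Submission where

-- Let v be a vertex and u ≠ v.  Inside the out-neighbourhood N⁺(v)
-- lie both the common out-neighbours N⁺(u) ∩ N⁺(v) of u and v and the
-- vertices N⁺(v) ∩ N⁻(v) joined to v in both directions (there are τ(v) of
-- the latter).  Two subsets of a set of size d⁺(v) overlap in at least
-- (their total size) − d⁺(v) points, and every point of this overlap is a
-- midpoint of a path u → x → v.  In a P₂,₂-free digraph there is at most one
-- such midpoint, so
--     |N⁺(u) ∩ N⁺(v)| + τ(v) ≤ d⁺(v) + 1,
-- which rearranges to the claim since τ(v) ≤ d⁺(v).

open import Defs
open import Data.Nat using (ℕ; _≤_; _+_; _∸_; suc; z≤n)
open import Data.Nat.Properties
  using (+-suc; ≤-trans; ≤-reflexive; +-monoˡ-≤; +-monoʳ-≤; m+n≤o⇒m≤o∸n; +-∸-comm; module ≤-Reasoning)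
open import Data.Bool using (Bool; true; false)
open import Data.Fin using (Fin)
open import Data.Fin.Properties using (_≟_)
open import Data.Fin.Subset using (Subset; _∈_; _∉_; _⊆_; _∩_; _∪_; ∣_∣; ⁅_⁆)
open import Data.Fin.Subset.Properties
  using ( p⊆q⇒∣p∣≤∣q∣; ∣p∩q∣≤∣p∣; p∩q⊆p; p∩q⊆q; x∈p∩q⁺; x∈p∩q⁻; x∈p∪q⁻
        ; nonempty?; Empty-unique; ∣⊥∣≡0; x∈⁅x⁆; ∣⁅x⁆∣≡1)
open import Data.Vec using ([]; _∷_)
open import Data.Vec.Properties using ([]=⇒lookup; lookup∘tabulate)
open import Data.Product using (_,_)
open import Data.Sum using ([_,_])
open import Data.Empty using (⊥-elim)
open import Relation.Nullary using (yes; no)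
open import Relation.Binary.PropositionalEquality
  using (_≡_; _≢_; refl; sym; trans; cong; subst; module ≡-Reasoning)

private
  variable
    n : ℕ

∣p∪q∣+∣p∩q∣≡∣p∣+∣q∣ : (p q : Subset n) → ∣ p ∪ q ∣ + ∣ p ∩ q ∣ ≡ ∣ p ∣ + ∣ q ∣
∣p∪q∣+∣p∩q∣≡∣p∣+∣q∣ []          []          = refl
∣p∪q∣+∣p∩q∣≡∣p∣+∣q∣ (true ∷ p)  (true ∷ q)  = cong suc (begin
  ∣ p ∪ q ∣ + suc ∣ p ∩ q ∣ ≡⟨ +-suc ∣ p ∪ q ∣ ∣ p ∩ q ∣ ⟩
  suc (∣ p ∪ q ∣ + ∣ p ∩ q ∣) ≡⟨ cong suc (∣p∪q∣+∣p∩q∣≡∣p∣+∣q∣ p q) ⟩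
  suc (∣ p ∣ + ∣ q ∣) ≡⟨ sym (+-suc ∣ p ∣ ∣ q ∣) ⟩
  ∣ p ∣ + suc ∣ q ∣ ∎)
  where open ≡-Reasoning
∣p∪q∣+∣p∩q∣≡∣p∣+∣q∣ (true ∷ p)  (false ∷ q) = cong suc (∣p∪q∣+∣p∩q∣≡∣p∣+∣q∣ p q)
∣p∪q∣+∣p∩q∣≡∣p∣+∣q∣ (false ∷ p) (true ∷ q)  =
  trans (cong suc (∣p∪q∣+∣p∩q∣≡∣p∣+∣q∣ p q)) (sym (+-suc ∣ p ∣ ∣ q ∣))
∣p∪q∣+∣p∩q∣≡∣p∣+∣q∣ (false ∷ p) (false ∷ q) = ∣p∪q∣+∣p∩q∣≡∣p∣+∣q∣ p q

overlap-bound : {p q r : Subset n} → p ⊆ r → q ⊆ r →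
  ∣ p ∣ + ∣ q ∣ ≤ ∣ r ∣ + ∣ p ∩ q ∣
overlap-bound {p = p} {q} {r} p⊆r q⊆r = begin
  ∣ p ∣ + ∣ q ∣             ≡⟨ sym (∣p∪q∣+∣p∩q∣≡∣p∣+∣q∣ p q) ⟩
  ∣ p ∪ q ∣ + ∣ p ∩ q ∣     ≤⟨ +-monoˡ-≤ ∣ p ∩ q ∣ (p⊆q⇒∣p∣≤∣q∣ p∪q⊆r) ⟩
  ∣ r ∣ + ∣ p ∩ q ∣         ∎
  where
  open ≤-Reasoning
  p∪q⊆r : p ∪ q ⊆ r
  p∪q⊆r x∈p∪q = [ p⊆r , q⊆r ] (x∈p∪q⁻ p q x∈p∪q)

∣p∣≤1 : ∀ {n} {p : Subset n} → (∀ {x y} → x ∈ p → y ∈ p → x ≡ y) → ∣ p ∣ ≤ 1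
∣p∣≤1 {n} {p} unique with nonempty? p
... | yes (x , x∈p) = ≤-trans (p⊆q⇒∣p∣≤∣q∣ p⊆⁅x⁆) (≤-reflexive (∣⁅x⁆∣≡1 x))
  where
  p⊆⁅x⁆ : p ⊆ ⁅ x ⁆
  p⊆⁅x⁆ y∈p = subst (_∈ ⁅ x ⁆) (unique x∈p y∈p) (x∈⁅x⁆ x)
... | no empty = ≤-trans (≤-reflexive (trans (cong ∣_∣ (Empty-unique empty)) (∣⊥∣≡0 n))) z≤n

∈N⁺⇒Arc : (D : Digraph n) {v x : Fin n} → x ∈ N⁺ D v → Arc D v x
∈N⁺⇒Arc D {v} {x} x∈ = trans (sym (lookup∘tabulate (arc D v) x)) ([]=⇒lookup x∈)

∈N⁻⇒Arc : (D : Digraph n) {v x : Fin n} → x ∈ N⁻ D v → Arc D x v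
∈N⁻⇒Arc D {v} {x} x∈ = trans (sym (lookup∘tabulate (λ w → arc D w v) x)) ([]=⇒lookup x∈)

Arc⇒≢ : (D : Digraph n) {x y : Fin n} → Arc D x y → x ≢ y
Arc⇒≢ D {x} x→y refl with trans (sym x→y) (loopless D x)
... | ()

two-paths⇒P22 : (D : Digraph n) {u v i j : Fin n} → u ≢ v → i ≢ j →
  Arc D u i → Arc D i v → Arc D u j → Arc D j v → HasP22 D
two-paths⇒P22 D {u} {v} {i} {j} u≢v i≢j u→i i→v u→j j→v =
  u , i , j , v ,
  Arc⇒≢ D u→i , Arc⇒≢ D u→j , u≢v , i≢j , Arc⇒≢ D i→v , Arc⇒≢ D j→v ,
  u→i , i→v , u→j , j→v

unique-midpoint : (D : Digraph n) → P22-free D → {u v : Fin n} → u ≢ v →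
  ∣ N⁺ D u ∩ N⁻ D v ∣ ≤ 1
unique-midpoint D free {u} {v} u≢v = ∣p∣≤1 same
  where
  same : ∀ {i j} → i ∈ N⁺ D u ∩ N⁻ D v → j ∈ N⁺ D u ∩ N⁻ D v → i ≡ j
  same {i} {j} i∈ j∈ with i ≟ j | x∈p∩q⁻ (N⁺ D u) (N⁻ D v) i∈ | x∈p∩q⁻ (N⁺ D u) (N⁻ D v) j∈
  ... | yes i≡j | _ | _ = i≡j
  ... | no i≢j | ui , iv | uj , jv = ⊥-elim (free (two-paths⇒P22 D u≢v i≢j
    (∈N⁺⇒Arc D ui) (∈N⁻⇒Arc D iv) (∈N⁺⇒Arc D uj) (∈N⁻⇒Arc D jv)))

lemma3p4 : ∀ {n} (D : Digraph n) → P22-free D → (v u : Fin n) →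
    u ∉ N⁺ D v → u ≢ v →
    ∣ N⁺ D u ∩ N⁺ D v ∣ ≤ (d⁺ D v ∸ τ D v) + 1
lemma3p4 D free v u _ u≢v =
  ≤-trans (m+n≤o⇒m≤o∸n ∣ common ∣ counting) (≤-reflexive (+-∸-comm 1 τ≤d⁺))
  where
  common twoWay : Subset _
  common = N⁺ D u ∩ N⁺ D v
  twoWay = N⁺ D v ∩ N⁻ D v

  τ≤d⁺ : τ D v ≤ d⁺ D v
  τ≤d⁺ = ∣p∩q∣≤∣p∣ (N⁺ D v) (N⁻ D v)

  overlap⊆midpoints : common ∩ twoWay ⊆ N⁺ D u ∩ N⁻ D v
  overlap⊆midpoints x∈ = x∈p∩q⁺ (p∩q⊆p (N⁺ D u) (N⁺ D v) (p∩q⊆p common twoWay x∈) ,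
                                 p∩q⊆q (N⁺ D v) (N⁻ D v) (p∩q⊆q common twoWay x∈))

  counting : ∣ common ∣ + τ D v ≤ d⁺ D v + 1
  counting = begin
    ∣ common ∣ + ∣ twoWay ∣
      ≤⟨ overlap-bound (p∩q⊆q (N⁺ D u) (N⁺ D v)) (p∩q⊆p (N⁺ D v) (N⁻ D v)) ⟩
    d⁺ D v + ∣ common ∩ twoWay ∣
      ≤⟨ +-monoʳ-≤ (d⁺ D v) (≤-trans (p⊆q⇒∣p∣≤∣q∣ overlap⊆midpoints)
                                     (unique-midpoint D free u≢v)) ⟩
    d⁺ D v + 1
      ∎
    where open ≤-Reasoning
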